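{- Let $G$ be a simple graph with $n$ vertices and $m\geq 1$ edges, and let $S(G)$ be its subdivision graph (obtained by inserting a new vertex of degree two on each edge of $G$), which has $n+m$ vertices and $2m$ edges. Then $$\frac{M_1(S(G))}{n+m}\leq \frac{M_2(S(G))}{2m},$$ with equality if and only if $G$ is regular. Here for a graph $H$, $M_1(H)=\sum_{v\in V(H)} d_v^2$ and $M_2(H)=\sum_{uv\in E(H)} d_u d_v$, with $d_v$ the degree of $v$ in $H$.
   Context: $M_1$ and $M_2$ are the first and second Zagreb indices; in $M_2$ each edge is counted once. -}

module Defs where

open import Data.Nat using (ℕ; _+_; _*_; _<_)
open import Data.Fin using (Fin; toℕ; _↑ˡ_; _↑ʳ_)
open import Data.Fin.Properties using (_≟_)
open import Data.Product using (Σ; _×_; _,_; proj₁; proj₂)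
open import Data.List using (List; []; _∷_; length; map; filter; concatMap; zip; allFin)
open import Data.List.Relation.Unary.All using (All)
open import Data.List.Relation.Unary.Unique.Propositional using (Unique)
open import Relation.Binary.PropositionalEquality using (_≡_)
open import Data.Nat.ListAction using (sum)

EdgeList : ℕ → Set
EdgeList n = List (Fin n × Fin n)

-- Simplicity: each edge stored as (u , v) with u < v (no loops, one fixed
-- orientation), and no edge listed twice (no multiple edges).
IsSimple : ∀ {n} → EdgeList n → Set
IsSimple E = All (λ e → toℕ (proj₁ e) < toℕ (proj₂ e)) E × Unique E

degree : ∀ {n} → EdgeList n → Fin n → ℕ
degree E v = length (filter (λ e → v ≟ proj₁ e) E)
           + length (filter (λ e → v ≟ proj₂ e) E)

M₁ : ∀ n → EdgeList n → ℕ
M₁ n E = sum (map (λ v → degree E v * degree E v) (allFin n))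

M₂ : ∀ {n} → EdgeList n → ℕ
M₂ E = sum (map (λ e → degree E (proj₁ e) * degree E (proj₂ e)) E)

Regular : ∀ n → EdgeList n → Set
Regular n E = Σ ℕ (λ k → (v : Fin n) → degree E v ≡ k)

-- Subdivision graph S(G) of G = (Fin n, E) with m = length E edges:
-- vertex set Fin (n + m); old vertex u ↦ inject+ m u, the new vertex on the
-- k-th edge is raise n k; the k-th edge (u , v) is replaced by the two edges
-- (u , w_k) and (v , w_k).
subdivision : ∀ {n} (E : EdgeList n) → EdgeList (n + length E)
subdivision {n} E =
  concatMap (λ p → ((proj₁ (proj₂ p) ↑ˡ m) , n ↑ʳ proj₁ p)
                 ∷ ((proj₂ (proj₂ p) ↑ˡ m) , n ↑ʳ proj₁ p) ∷ [])
            (zip (allFin m) E)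
  where m = length E

module Submission where

-- Write d v for the degree of v in G, m for the number of edges,
-- Q = Σ_v d_v² (= M₁ G) and D = Σ_u Σ_v (d_u - d_v)² for the dispersion of
-- the degree sequence.  In S(G) every old vertex keeps its degree d_v and
-- every new vertex has degree 2, so
--     M₁(S G) = Q + 4m   and   M₂(S G) = Σ_{uv ∈ E} 2(d_u + d_v) = 2Q,
-- the last step by double counting (Σ_{uv ∈ E} (d_u + d_v) = Σ_v d_v²).
-- Lagrange's identity 2nQ = 2(Σ_v d_v)² + D together with the handshake
-- lemma Σ_v d_v = 2m then gives the exact relation
--     M₂(S G)·(n + m) = M₁(S G)·2m + D,
-- from which the inequality follows, with equality iff D = 0, i.e. iff all
-- degrees coincide.

open import Defs
open import Data.Nat using (ℕ; zero; suc; _+_; _*_; _≤_; _≥_; _<_; ∣_-_∣)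
open import Data.Nat.Properties
  using ( +-*-semiring; +-assoc; +-comm; +-identityʳ; *-zeroʳ; *-identityˡ; *-identityʳ
        ; *-distribˡ-+; *-comm; m+n≡0⇒m≡0; m+n≡0⇒n≡0; m*n≡0⇒m≡0∨n≡0
        ; <-≤-trans; m≤m+n; <⇒≢; ≤-total; m≤n⇒∃[o]m+o≡n; ∣-∣-comm; ∣m-m+n∣≡n
        ; ∣n-n∣≡0; ∣m-n∣≡0⇒m≡n; +-cancelˡ-≡; suc-injective )
open import Data.Nat.Tactic.RingSolver using (solve-∀)
open import Data.Nat.ListAction using (sum)
open import Data.Nat.ListAction.Properties using (sum-++)
open import Algebra.Properties.Semiring.Sum +-*-semiring
  using (sum-syntax; ∑-distrib-+; *-distribˡ-sum; *-distribʳ-sum; sum-cong-≗; sum-replicate-zero)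
  renaming (sum to ∑)
open import Data.Fin using (Fin; zero; suc; toℕ; _↑ˡ_; _↑ʳ_)
open import Data.Fin.Properties
  using (_≟_; toℕ-↑ˡ; toℕ-↑ʳ; toℕ<n; ↑ˡ-injective; ↑ʳ-injective)
open import Data.List
  using (List; []; _∷_; _++_; length; map; filter; concatMap; zip; allFin; tabulate)
open import Data.List.Properties using (map-cong; map-++; map-tabulate; length-tabulate)
open import Data.Product using (Σ; _×_; _,_; proj₁; proj₂)
open import Data.Sum using (inj₁; inj₂)
open import Data.Bool using (if_then_else_)
open import Function using (Injective)
open import Function.Bundles using (_⇔_; mk⇔)
open import Function.Properties.Equivalence using () renaming (trans to ⇔-trans)
open import Relation.Nullary using (Dec; yes; no; does; ¬_; contradiction)
open import Relation.Unary using (Pred; Decidable)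
open import Relation.Binary.PropositionalEquality
  using (_≡_; _≢_; refl; sym; trans; cong; cong₂; subst; module ≡-Reasoning)

open ≡-Reasoning

∑ₗ : {A : Set} → List A → (A → ℕ) → ℕ
∑ₗ xs f = sum (map f xs)

infixl 10 ∑ₗ
syntax ∑ₗ xs (λ x → e) = ∑[ x ∈ xs ] e

module _ {A : Set} where

  ∑ₗ-cong : {f g : A → ℕ} (xs : List A) → (∀ x → f x ≡ g x) → ∑ₗ xs f ≡ ∑ₗ xs g
  ∑ₗ-cong xs f≗g = cong sum (map-cong f≗g xs)

  ∑ₗ-distrib-+ : (f g : A → ℕ) (xs : List A) →
                 ∑[ x ∈ xs ] (f x + g x) ≡ ∑ₗ xs f + ∑ₗ xs g
  ∑ₗ-distrib-+ f g []       = refl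
  ∑ₗ-distrib-+ f g (x ∷ xs) = begin
    (f x + g x) + ∑[ y ∈ xs ] (f y + g y)  ≡⟨ cong ((f x + g x) +_) (∑ₗ-distrib-+ f g xs) ⟩
    (f x + g x) + (∑ₗ xs f + ∑ₗ xs g)      ≡⟨ interchange (f x) (g x) _ _ ⟩
    (f x + ∑ₗ xs f) + (g x + ∑ₗ xs g)      ∎
    where
    interchange : ∀ a b c d → (a + b) + (c + d) ≡ (a + c) + (b + d)
    interchange = solve-∀

  ∑ₗ-*ˡ : (c : ℕ) (f : A → ℕ) (xs : List A) → ∑[ x ∈ xs ] (c * f x) ≡ c * ∑ₗ xs f
  ∑ₗ-*ˡ c f []       = sym (*-zeroʳ c)
  ∑ₗ-*ˡ c f (x ∷ xs) = trans (cong (c * f x +_) (∑ₗ-*ˡ c f xs)) (sym (*-distribˡ-+ c (f x) _))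

  ∑ₗ-concatMap : {B : Set} (f : B → ℕ) (g : A → List B) (xs : List A) →
                 ∑ₗ (concatMap g xs) f ≡ ∑[ x ∈ xs ] ∑ₗ (g x) f
  ∑ₗ-concatMap f g []       = refl
  ∑ₗ-concatMap f g (x ∷ xs) = begin
    sum (map f (g x ++ concatMap g xs))            ≡⟨ cong sum (map-++ f (g x) (concatMap g xs)) ⟩
    sum (map f (g x) ++ map f (concatMap g xs))    ≡⟨ sum-++ (map f (g x)) _ ⟩
    ∑ₗ (g x) f + ∑ₗ (concatMap g xs) f             ≡⟨ cong (∑ₗ (g x) f +_) (∑ₗ-concatMap f g xs) ⟩
    ∑ₗ (g x) f + ∑[ y ∈ xs ] ∑ₗ (g y) f            ∎

module _ {A B : Set} where

  ∑ₗ-zip-proj₁ : (f : A → ℕ) (xs : List A) (ys : List B) → length xs ≡ length ys →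
                 ∑[ p ∈ zip xs ys ] f (proj₁ p) ≡ ∑ₗ xs f
  ∑ₗ-zip-proj₁ f []       []       _  = refl
  ∑ₗ-zip-proj₁ f (x ∷ xs) (y ∷ ys) eq = cong (f x +_) (∑ₗ-zip-proj₁ f xs ys (suc-injective eq))

  ∑ₗ-zip-proj₂ : (f : B → ℕ) (xs : List A) (ys : List B) → length xs ≡ length ys →
                 ∑[ p ∈ zip xs ys ] f (proj₂ p) ≡ ∑ₗ ys f
  ∑ₗ-zip-proj₂ f []       []       _  = refl
  ∑ₗ-zip-proj₂ f (x ∷ xs) (y ∷ ys) eq = cong (f y +_) (∑ₗ-zip-proj₂ f xs ys (suc-injective eq))

𝟙 : {P : Set} → Dec P → ℕ
𝟙 P? = if does P? then 1 else 0

𝟙-yes : {P : Set} (P? : Dec P) → P → 𝟙 P? ≡ 1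
𝟙-yes (yes _) _ = refl
𝟙-yes (no ¬p) p = contradiction p ¬p

𝟙-no : {P : Set} (P? : Dec P) → ¬ P → 𝟙 P? ≡ 0
𝟙-no (yes p) ¬p = contradiction p ¬p
𝟙-no (no _)  _  = refl

length-filter : {A : Set} {P : Pred A _} (P? : Decidable P) (xs : List A) →
                length (filter P? xs) ≡ ∑[ x ∈ xs ] 𝟙 (P? x)
length-filter P? []       = refl
length-filter P? (x ∷ xs) with P? x
... | yes _ = cong suc (length-filter P? xs)
... | no  _ = length-filter P? xs

module _ {n : ℕ} where

  𝟙-≟-sym : (x y : Fin n) → 𝟙 (x ≟ y) ≡ 𝟙 (y ≟ x)
  𝟙-≟-sym x y with x ≟ y
  ... | yes x≡y = sym (𝟙-yes (y ≟ x) (sym x≡y))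
  ... | no  x≢y = sym (𝟙-no (y ≟ x) (λ y≡x → x≢y (sym y≡x)))

  𝟙-≟-injective : {k : ℕ} (f : Fin n → Fin k) → Injective _≡_ _≡_ f →
                  (x y : Fin n) → 𝟙 (f x ≟ f y) ≡ 𝟙 (x ≟ y)
  𝟙-≟-injective f f-inj x y with x ≟ y
  ... | yes x≡y = 𝟙-yes (f x ≟ f y) (cong f x≡y)
  ... | no  x≢y = 𝟙-no (f x ≟ f y) (λ fx≡fy → x≢y (f-inj fx≡fy))

↑ˡ≢↑ʳ : ∀ {n m} (u : Fin n) (k : Fin m) → u ↑ˡ m ≢ n ↑ʳ k
↑ˡ≢↑ʳ {n} {m} u k eq = <⇒≢ u<n+k (begin
  toℕ u            ≡⟨ toℕ-↑ˡ u m ⟨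
  toℕ (u ↑ˡ m)     ≡⟨ cong toℕ eq ⟩
  toℕ (n ↑ʳ k)     ≡⟨ toℕ-↑ʳ n k ⟩
  n + toℕ k        ∎)
  where
  u<n+k : toℕ u < n + toℕ k
  u<n+k = <-≤-trans (toℕ<n u) (m≤m+n n (toℕ k))

∑-const : ∀ n (c : ℕ) → ∑[ i < n ] c ≡ n * c
∑-const zero    c = refl
∑-const (suc n) c = cong (c +_) (∑-const n c)

∑-split : ∀ n m (f : Fin (n + m) → ℕ) →
          ∑[ i < n + m ] f i ≡ ∑[ u < n ] f (u ↑ˡ m) + ∑[ k < m ] f (n ↑ʳ k)
∑-split zero    m f = refl
∑-split (suc n) m f =
  trans (cong (f zero +_) (∑-split n m (λ i → f (suc i)))) (sym (+-assoc (f zero) _ _))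

∑≡0 : ∀ {n} (f : Fin n → ℕ) → (∀ i → f i ≡ 0) → ∑[ i < n ] f i ≡ 0
∑≡0 {n} f f≡0 = trans (sum-cong-≗ f≡0) (sum-replicate-zero n)

∑≡0⇒≡0 : ∀ {n} (f : Fin n → ℕ) → ∑[ i < n ] f i ≡ 0 → ∀ i → f i ≡ 0
∑≡0⇒≡0 f eq zero    = m+n≡0⇒m≡0 (f zero) eq
∑≡0⇒≡0 f eq (suc i) = ∑≡0⇒≡0 (λ j → f (suc j)) (m+n≡0⇒n≡0 (f zero) eq) i

∑-pick : ∀ {n} (f : Fin n → ℕ) (a : Fin n) → ∑[ v < n ] (f v * 𝟙 (v ≟ a)) ≡ f a
∑-pick {suc n} f zero = begin
  f zero * 1 + ∑[ i < n ] (f (suc i) * 0)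
    ≡⟨ cong₂ _+_ (*-identityʳ (f zero)) (∑≡0 (λ i → f (suc i) * 0) (λ i → *-zeroʳ (f (suc i)))) ⟩
  f zero + 0
    ≡⟨ +-identityʳ (f zero) ⟩
  f zero
    ∎
∑-pick {suc n} f (suc a) =
  trans (cong (_+ ∑[ i < n ] (f (suc i) * 𝟙 (i ≟ a))) (*-zeroʳ (f zero)))
        (∑-pick (λ i → f (suc i)) a)

∑-𝟙 : ∀ {n} (a : Fin n) → ∑[ v < n ] 𝟙 (v ≟ a) ≡ 1
∑-𝟙 a = trans (sum-cong-≗ (λ v → sym (*-identityˡ (𝟙 (v ≟ a))))) (∑-pick (λ _ → 1) a)

∑ₗ-allFin : ∀ n (f : Fin n → ℕ) → ∑[ i ∈ allFin n ] f i ≡ ∑[ i < n ] f i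
∑ₗ-allFin n f = trans (cong sum (map-tabulate (λ i → i) f)) (sum-tabulate n f)
  where
  sum-tabulate : ∀ n (g : Fin n → ℕ) → sum (tabulate g) ≡ ∑[ i < n ] g i
  sum-tabulate zero    g = refl
  sum-tabulate (suc n) g = cong (g zero +_) (sum-tabulate n (λ i → g (suc i)))

∑-∑ₗ-comm : ∀ {n} {A : Set} (g : Fin n → A → ℕ) (xs : List A) →
            ∑[ v < n ] ∑ₗ xs (g v) ≡ ∑[ x ∈ xs ] ∑[ v < n ] g v x
∑-∑ₗ-comm {n} g []       = sum-replicate-zero n
∑-∑ₗ-comm     g (x ∷ xs) =
  trans (∑-distrib-+ (λ v → g v x) (λ v → ∑ₗ xs (g v)))
        (cong (∑ (λ v → g v x) +_) (∑-∑ₗ-comm g xs))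

-- Degrees as incidence counts.

incidence : ∀ {n} → Fin n → Fin n × Fin n → ℕ
incidence v e = 𝟙 (v ≟ proj₁ e) + 𝟙 (v ≟ proj₂ e)

degree-∑ : ∀ {n} (E : EdgeList n) (v : Fin n) → degree E v ≡ ∑[ e ∈ E ] incidence v e
degree-∑ E v = begin
  length (filter (λ e → v ≟ proj₁ e) E) + length (filter (λ e → v ≟ proj₂ e) E)
    ≡⟨ cong₂ _+_ (length-filter (λ e → v ≟ proj₁ e) E) (length-filter (λ e → v ≟ proj₂ e) E) ⟩
  ∑[ e ∈ E ] 𝟙 (v ≟ proj₁ e) + ∑[ e ∈ E ] 𝟙 (v ≟ proj₂ e)
    ≡⟨ ∑ₗ-distrib-+ (λ e → 𝟙 (v ≟ proj₁ e)) (λ e → 𝟙 (v ≟ proj₂ e)) E ⟨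
  ∑[ e ∈ E ] incidence v e
    ∎

degree-concatMap : ∀ {n} {A : Set} (g : A → EdgeList n) (xs : List A) (v : Fin n) →
                   degree (concatMap g xs) v ≡ ∑[ x ∈ xs ] ∑[ e ∈ g x ] incidence v e
degree-concatMap g xs v = trans (degree-∑ (concatMap g xs) v) (∑ₗ-concatMap (incidence v) g xs)

double-counting : ∀ {n} (E : EdgeList n) (f : Fin n → ℕ) →
                  ∑[ v < n ] (f v * degree E v) ≡ ∑[ e ∈ E ] (f (proj₁ e) + f (proj₂ e))
double-counting {n} E f = begin
  ∑[ v < n ] (f v * degree E v)                  ≡⟨ sum-cong-≗ (λ v → cong (f v *_) (degree-∑ E v)) ⟩
  ∑[ v < n ] (f v * ∑[ e ∈ E ] incidence v e)    ≡⟨ sum-cong-≗ (λ v → ∑ₗ-*ˡ (f v) (incidence v) E) ⟨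
  ∑[ v < n ] ∑[ e ∈ E ] (f v * incidence v e)    ≡⟨ ∑-∑ₗ-comm (λ v e → f v * incidence v e) E ⟩
  ∑[ e ∈ E ] ∑[ v < n ] (f v * incidence v e)    ≡⟨ ∑ₗ-cong E ends ⟩
  ∑[ e ∈ E ] (f (proj₁ e) + f (proj₂ e))         ∎
  where
  ends : ∀ e → ∑[ v < n ] (f v * incidence v e) ≡ f (proj₁ e) + f (proj₂ e)
  ends (a , b) = begin
    ∑[ v < n ] (f v * incidence v (a , b))
      ≡⟨ sum-cong-≗ (λ v → *-distribˡ-+ (f v) (𝟙 (v ≟ a)) (𝟙 (v ≟ b))) ⟩
    ∑[ v < n ] (f v * 𝟙 (v ≟ a) + f v * 𝟙 (v ≟ b))
      ≡⟨ ∑-distrib-+ (λ v → f v * 𝟙 (v ≟ a)) (λ v → f v * 𝟙 (v ≟ b)) ⟩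
    ∑[ v < n ] (f v * 𝟙 (v ≟ a)) + ∑[ v < n ] (f v * 𝟙 (v ≟ b))
      ≡⟨ cong₂ _+_ (∑-pick f a) (∑-pick f b) ⟩
    f a + f b
      ∎

handshake : ∀ {n} (E : EdgeList n) → ∑[ v < n ] degree E v ≡ 2 * length E
handshake {n} E = begin
  ∑[ v < n ] degree E v            ≡⟨ sum-cong-≗ (λ v → *-identityˡ (degree E v)) ⟨
  ∑[ v < n ] (1 * degree E v)      ≡⟨ double-counting E (λ _ → 1) ⟩
  ∑[ e ∈ E ] 2                     ≡⟨ ∑ₗ-const E ⟩
  length E * 2                     ≡⟨ *-comm (length E) 2 ⟩
  2 * length E                     ∎
  where
  ∑ₗ-const : {A : Set} (xs : List A) → ∑[ x ∈ xs ] 2 ≡ length xs * 2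
  ∑ₗ-const []       = refl
  ∑ₗ-const (_ ∷ xs) = cong (2 +_) (∑ₗ-const xs)

-- The subdivision graph.

incidence-old : ∀ {n m} (u a : Fin n) (k : Fin m) →
                incidence (u ↑ˡ m) (a ↑ˡ m , n ↑ʳ k) ≡ 𝟙 (u ≟ a)
incidence-old {n} {m} u a k = begin
  𝟙 (u ↑ˡ m ≟ a ↑ˡ m) + 𝟙 (u ↑ˡ m ≟ n ↑ʳ k)
    ≡⟨ cong₂ _+_ (𝟙-≟-injective (_↑ˡ m) (λ {x} {y} → ↑ˡ-injective m x y) u a)
                 (𝟙-no (u ↑ˡ m ≟ n ↑ʳ k) (↑ˡ≢↑ʳ u k)) ⟩
  𝟙 (u ≟ a) + 0
    ≡⟨ +-identityʳ _ ⟩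
  𝟙 (u ≟ a)
    ∎

incidence-new : ∀ {n m} (j : Fin m) (a : Fin n) (k : Fin m) →
                incidence (n ↑ʳ j) (a ↑ˡ m , n ↑ʳ k) ≡ 𝟙 (j ≟ k)
incidence-new {n} {m} j a k =
  cong₂ _+_ (𝟙-no (n ↑ʳ j ≟ a ↑ˡ m) (λ eq → ↑ˡ≢↑ʳ a j (sym eq)))
            (𝟙-≟-injective (n ↑ʳ_) (λ {x} {y} → ↑ʳ-injective n x y) j k)

sumOfSquares : ∀ {n} → (Fin n → ℕ) → ℕ
sumOfSquares {n} f = ∑[ i < n ] (f i * f i)

module Subdivision {n : ℕ} (E : EdgeList n) where

  m : ℕ
  m = length E

  halves : Fin m × (Fin n × Fin n) → EdgeList (n + m)
  halves (k , a , b) = (a ↑ˡ m , n ↑ʳ k) ∷ (b ↑ˡ m , n ↑ʳ k) ∷ []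

  numbered : List (Fin m × (Fin n × Fin n))
  numbered = zip (allFin m) E

  length-allFin : length (allFin m) ≡ m
  length-allFin = length-tabulate (λ i → i)

  -- Definitionally, S = concatMap halves numbered.
  S : EdgeList (n + m)
  S = subdivision E

  degree-old : ∀ u → degree S (u ↑ˡ m) ≡ degree E u
  degree-old u = begin
    degree S (u ↑ˡ m)
      ≡⟨ degree-concatMap halves numbered (u ↑ˡ m) ⟩
    ∑[ p ∈ numbered ] ∑[ e ∈ halves p ] incidence (u ↑ˡ m) e
      ≡⟨ ∑ₗ-cong numbered halves-at-u ⟩
    ∑[ p ∈ numbered ] incidence u (proj₂ p)
      ≡⟨ ∑ₗ-zip-proj₂ (incidence u) (allFin m) E length-allFin ⟩
    ∑[ e ∈ E ] incidence u e
      ≡⟨ degree-∑ E u ⟨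
    degree E u
      ∎
    where
    halves-at-u : ∀ p → ∑[ e ∈ halves p ] incidence (u ↑ˡ m) e ≡ incidence u (proj₂ p)
    halves-at-u (k , a , b) =
      cong₂ _+_ (incidence-old u a k) (trans (+-identityʳ _) (incidence-old u b k))

  degree-new : ∀ j → degree S (n ↑ʳ j) ≡ 2
  degree-new j = begin
    degree S (n ↑ʳ j)
      ≡⟨ degree-concatMap halves numbered (n ↑ʳ j) ⟩
    ∑[ p ∈ numbered ] ∑[ e ∈ halves p ] incidence (n ↑ʳ j) e
      ≡⟨ ∑ₗ-cong numbered halves-at-j ⟩
    ∑[ p ∈ numbered ] (2 * 𝟙 (j ≟ proj₁ p))
      ≡⟨ ∑ₗ-zip-proj₁ (λ k → 2 * 𝟙 (j ≟ k)) (allFin m) E length-allFin ⟩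
    ∑[ k ∈ allFin m ] (2 * 𝟙 (j ≟ k))
      ≡⟨ ∑ₗ-allFin m (λ k → 2 * 𝟙 (j ≟ k)) ⟩
    ∑[ k < m ] (2 * 𝟙 (j ≟ k))
      ≡⟨ *-distribˡ-sum 2 (λ k → 𝟙 (j ≟ k)) ⟨
    2 * ∑[ k < m ] 𝟙 (j ≟ k)
      ≡⟨ cong (2 *_) (trans (sum-cong-≗ (𝟙-≟-sym j)) (∑-𝟙 j)) ⟩
    2
      ∎
    where
    halves-at-j : ∀ p → ∑[ e ∈ halves p ] incidence (n ↑ʳ j) e ≡ 2 * 𝟙 (j ≟ proj₁ p)
    halves-at-j (k , a , b) = cong₂ _+_ (incidence-new j a k) (cong (_+ 0) (incidence-new j b k))

  M₁-subdivision : M₁ (n + m) S ≡ sumOfSquares (degree E) + 4 * m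
  M₁-subdivision = begin
    M₁ (n + m) S
      ≡⟨ ∑ₗ-allFin (n + m) (λ v → degree S v * degree S v) ⟩
    ∑[ v < n + m ] (degree S v * degree S v)
      ≡⟨ ∑-split n m (λ v → degree S v * degree S v) ⟩
    ∑[ u < n ] (degree S (u ↑ˡ m) * degree S (u ↑ˡ m))
      + ∑[ k < m ] (degree S (n ↑ʳ k) * degree S (n ↑ʳ k))
      ≡⟨ cong₂ _+_ (sum-cong-≗ (λ u → cong₂ _*_ (degree-old u) (degree-old u)))
                   (sum-cong-≗ (λ k → cong₂ _*_ (degree-new k) (degree-new k))) ⟩
    sumOfSquares (degree E) + ∑[ k < m ] 4
      ≡⟨ cong (sumOfSquares (degree E) +_) (trans (∑-const m 4) (*-comm m 4)) ⟩
    sumOfSquares (degree E) + 4 * m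
      ∎

  -- M₂(S G) = 2·M₁ G: each edge a — w_k contributes 2·d(a), and every
  -- vertex a lies on d(a) edges of G.
  M₂-subdivision : M₂ S ≡ 2 * sumOfSquares (degree E)
  M₂-subdivision = begin
    M₂ S
      ≡⟨ ∑ₗ-concatMap weight halves numbered ⟩
    ∑[ p ∈ numbered ] ∑[ e ∈ halves p ] weight e
      ≡⟨ ∑ₗ-cong numbered halves-weight ⟩
    ∑[ p ∈ numbered ] (2 * (degree E (proj₁ (proj₂ p)) + degree E (proj₂ (proj₂ p))))
      ≡⟨ ∑ₗ-zip-proj₂ (λ e → 2 * (degree E (proj₁ e) + degree E (proj₂ e)))
                      (allFin m) E length-allFin ⟩
    ∑[ e ∈ E ] (2 * (degree E (proj₁ e) + degree E (proj₂ e)))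
      ≡⟨ ∑ₗ-*ˡ 2 (λ e → degree E (proj₁ e) + degree E (proj₂ e)) E ⟩
    2 * ∑[ e ∈ E ] (degree E (proj₁ e) + degree E (proj₂ e))
      ≡⟨ cong (2 *_) (double-counting E (degree E)) ⟨
    2 * sumOfSquares (degree E)
      ∎
    where
    weight : Fin (n + m) × Fin (n + m) → ℕ
    weight e = degree S (proj₁ e) * degree S (proj₂ e)

    halves-weight : ∀ p → ∑[ e ∈ halves p ] weight e
                          ≡ 2 * (degree E (proj₁ (proj₂ p)) + degree E (proj₂ (proj₂ p)))
    halves-weight (k , a , b) = begin
      degree S (a ↑ˡ m) * degree S (n ↑ʳ k) + (degree S (b ↑ˡ m) * degree S (n ↑ʳ k) + 0)
        ≡⟨ cong₂ _+_ (cong₂ _*_ (degree-old a) (degree-new k))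
                     (cong (_+ 0) (cong₂ _*_ (degree-old b) (degree-new k))) ⟩
      degree E a * 2 + (degree E b * 2 + 0)
        ≡⟨ regroup (degree E a) (degree E b) ⟩
      2 * (degree E a + degree E b)
        ∎
      where
      regroup : ∀ x y → x * 2 + (y * 2 + 0) ≡ 2 * (x + y)
      regroup = solve-∀

-- Lagrange's identity over ℕ.

sqDiff : ℕ → ℕ → ℕ
sqDiff a b = ∣ a - b ∣ * ∣ a - b ∣

square-sum-ordered : ∀ {a b} → a ≤ b → a * a + b * b ≡ 2 * (a * b) + sqDiff a b
square-sum-ordered {a} a≤b with m≤n⇒∃[o]m+o≡n a≤b
... | k , refl = begin
  a * a + (a + k) * (a + k)         ≡⟨ gap a k ⟩
  2 * (a * (a + k)) + k * k         ≡⟨ cong (λ x → 2 * (a * (a + k)) + x * x) (∣m-m+n∣≡n a k) ⟨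
  2 * (a * (a + k)) + sqDiff a (a + k) ∎
  where
  gap : ∀ a k → a * a + (a + k) * (a + k) ≡ 2 * (a * (a + k)) + k * k
  gap = solve-∀

square-sum : ∀ a b → a * a + b * b ≡ 2 * (a * b) + sqDiff a b
square-sum a b with ≤-total a b
... | inj₁ a≤b = square-sum-ordered a≤b
... | inj₂ b≤a = begin
  a * a + b * b             ≡⟨ +-comm (a * a) (b * b) ⟩
  b * b + a * a             ≡⟨ square-sum-ordered b≤a ⟩
  2 * (b * a) + sqDiff b a  ≡⟨ cong₂ (λ p x → 2 * p + x * x) (*-comm b a) (∣-∣-comm b a) ⟩
  2 * (a * b) + sqDiff a b  ∎

dispersion : ∀ {n} → (Fin n → ℕ) → ℕ
dispersion {n} f = ∑[ i < n ] ∑[ j < n ] sqDiff (f i) (f j)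

lagrange : ∀ {n} (f : Fin n → ℕ) →
           2 * (n * sumOfSquares f) ≡ 2 * (∑ f * ∑ f) + dispersion f
lagrange {n} f = begin
  2 * (n * Q)
    ≡⟨ double (n * Q) ⟩
  n * Q + n * Q
    ≡⟨ pairs-squares ⟨
  ∑[ i < n ] ∑[ j < n ] (f i * f i + f j * f j)
    ≡⟨ sum-cong-≗ (λ i → sum-cong-≗ (λ j → square-sum (f i) (f j))) ⟩
  ∑[ i < n ] ∑[ j < n ] (2 * (f i * f j) + δ i j)
    ≡⟨ sum-cong-≗ (λ i → ∑-distrib-+ (λ j → 2 * (f i * f j)) (δ i)) ⟩
  ∑[ i < n ] (∑[ j < n ] (2 * (f i * f j)) + ∑ (δ i))
    ≡⟨ ∑-distrib-+ (λ i → ∑[ j < n ] (2 * (f i * f j))) (λ i → ∑ (δ i)) ⟩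
  ∑[ i < n ] ∑[ j < n ] (2 * (f i * f j)) + dispersion f
    ≡⟨ cong (_+ dispersion f) pairs-products ⟩
  2 * (∑ f * ∑ f) + dispersion f
    ∎
  where
  Q : ℕ
  Q = sumOfSquares f

  δ : Fin n → Fin n → ℕ
  δ i j = sqDiff (f i) (f j)

  double : ∀ x → 2 * x ≡ x + x
  double = solve-∀

  pairs-squares : ∑[ i < n ] ∑[ j < n ] (f i * f i + f j * f j) ≡ n * Q + n * Q
  pairs-squares = begin
    ∑[ i < n ] ∑[ j < n ] (f i * f i + f j * f j)
      ≡⟨ sum-cong-≗ (λ i → ∑-distrib-+ (λ _ → f i * f i) (λ j → f j * f j)) ⟩
    ∑[ i < n ] (∑[ j < n ] (f i * f i) + Q)
      ≡⟨ sum-cong-≗ (λ i → cong (_+ Q) (∑-const n (f i * f i))) ⟩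
    ∑[ i < n ] (n * (f i * f i) + Q)
      ≡⟨ ∑-distrib-+ (λ i → n * (f i * f i)) (λ _ → Q) ⟩
    ∑[ i < n ] (n * (f i * f i)) + ∑[ i < n ] Q
      ≡⟨ cong₂ _+_ (*-distribˡ-sum n (λ i → f i * f i)) (sym (∑-const n Q)) ⟨
    n * Q + n * Q
      ∎

  pairs-products : ∑[ i < n ] ∑[ j < n ] (2 * (f i * f j)) ≡ 2 * (∑ f * ∑ f)
  pairs-products = begin
    ∑[ i < n ] ∑[ j < n ] (2 * (f i * f j))  ≡⟨ sum-cong-≗ (λ i → *-distribˡ-sum 2 (λ j → f i * f j)) ⟨
    ∑[ i < n ] (2 * ∑[ j < n ] (f i * f j))  ≡⟨ sum-cong-≗ (λ i → cong (2 *_) (*-distribˡ-sum (f i) f)) ⟨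
    ∑[ i < n ] (2 * (f i * ∑ f))             ≡⟨ *-distribˡ-sum 2 (λ i → f i * ∑ f) ⟨
    2 * ∑[ i < n ] (f i * ∑ f)               ≡⟨ cong (2 *_) (*-distribʳ-sum (∑ f) f) ⟨
    2 * (∑ f * ∑ f)                          ∎

Constant : ∀ {n} → (Fin n → ℕ) → Set
Constant {n} f = Σ ℕ (λ k → (i : Fin n) → f i ≡ k)

constant⇒dispersion≡0 : ∀ {n} (f : Fin n → ℕ) → Constant f → dispersion f ≡ 0
constant⇒dispersion≡0 {n} f (k , f≡k) =
  ∑≡0 (λ i → ∑[ j < n ] δ i j) (λ i → ∑≡0 (δ i) (δ≡0 i))
  where
  δ : Fin n → Fin n → ℕ
  δ i j = sqDiff (f i) (f j)

  δ≡0 : ∀ i j → δ i j ≡ 0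
  δ≡0 i j rewrite f≡k i | f≡k j | ∣n-n∣≡0 k = refl

dispersion≡0⇒constant : ∀ {n} (f : Fin n → ℕ) → dispersion f ≡ 0 → Constant f
dispersion≡0⇒constant {zero}  f _   = 0 , λ ()
dispersion≡0⇒constant {suc n} f D≡0 = f zero , λ i → ∣m-n∣≡0⇒m≡n (square≡0 (δ≡0 i zero))
  where
  δ : Fin (suc n) → Fin (suc n) → ℕ
  δ i j = sqDiff (f i) (f j)

  δ≡0 : ∀ i j → δ i j ≡ 0
  δ≡0 i = ∑≡0⇒≡0 (δ i) (∑≡0⇒≡0 (λ i′ → ∑ (δ i′)) D≡0 i)

  square≡0 : ∀ {x} → x * x ≡ 0 → x ≡ 0
  square≡0 {x} x²≡0 with m*n≡0⇒m≡0∨n≡0 x x²≡0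
  ... | inj₁ x≡0 = x≡0
  ... | inj₂ x≡0 = x≡0

dispersion≡0⇔constant : ∀ {n} (f : Fin n → ℕ) → dispersion f ≡ 0 ⇔ Constant f
dispersion≡0⇔constant f = mk⇔ (dispersion≡0⇒constant f) (constant⇒dispersion≡0 f)

zagreb-gap : ∀ {n} (E : EdgeList n) →
             M₂ (subdivision E) * (n + length E)
               ≡ M₁ (n + length E) (subdivision E) * (2 * length E) + dispersion (degree E)
zagreb-gap {n} E = begin
  M₂ (subdivision E) * (n + m)              ≡⟨ cong (_* (n + m)) M₂-subdivision ⟩
  2 * Q * (n + m)                           ≡⟨ expand Q n m ⟩
  2 * (n * Q) + 2 * Q * m                   ≡⟨ cong (_+ 2 * Q * m) (lagrange (degree E)) ⟩
  (2 * (∑ d * ∑ d) + D) + 2 * Q * m         ≡⟨ cong (λ s → (2 * (s * s) + D) + 2 * Q * m) (handshake E) ⟩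
  (2 * (2 * m * (2 * m)) + D) + 2 * Q * m   ≡⟨ collect Q m D ⟩
  (Q + 4 * m) * (2 * m) + D                 ≡⟨ cong (λ x → x * (2 * m) + D) M₁-subdivision ⟨
  M₁ (n + m) (subdivision E) * (2 * m) + D  ∎
  where
  open Subdivision E using (m; M₁-subdivision; M₂-subdivision)

  d : Fin n → ℕ
  d = degree E

  Q D : ℕ
  Q = sumOfSquares d
  D = dispersion d

  expand : ∀ q n m → 2 * q * (n + m) ≡ 2 * (n * q) + 2 * q * m
  expand = solve-∀

  collect : ∀ q m D → (2 * (2 * m * (2 * m)) + D) + 2 * q * m ≡ (q + 4 * m) * (2 * m) + D
  collect = solve-∀

≤-by-gap : ∀ {a b d : ℕ} → b ≡ a + d → a ≤ b × (a ≡ b ⇔ d ≡ 0)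
≤-by-gap {a} {b} {d} b≡a+d = subst (a ≤_) (sym b≡a+d) (m≤m+n a d) , mk⇔ gap≡0 no-gap
  where
  gap≡0 : a ≡ b → d ≡ 0
  gap≡0 a≡b = +-cancelˡ-≡ a d 0 (trans (sym b≡a+d) (trans (sym a≡b) (sym (+-identityʳ a))))

  no-gap : d ≡ 0 → a ≡ b
  no-gap d≡0 = trans (sym (+-identityʳ a)) (trans (cong (a +_) (sym d≡0)) (sym b≡a+d))

theorem3 : (n : ℕ) (E : EdgeList n) → IsSimple E → length E ≥ 1 →
    (M₁ (n + length E) (subdivision E) * (2 * length E)
       ≤ M₂ (subdivision E) * (n + length E))
    × ((M₁ (n + length E) (subdivision E) * (2 * length E)
         ≡ M₂ (subdivision E) * (n + length E)) ⇔ Regular n E)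
theorem3 n E _ _ =
  let inequality , equality⇔no-gap = ≤-by-gap (zagreb-gap E)
  in  inequality , ⇔-trans equality⇔no-gap (dispersion≡0⇔constant (degree E))
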